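{- Let $G$ be a finite abelian group that is not an elementary abelian $2$-group. If $|G|-1$ is an odd prime, then $G$ does not have the $k$-if property for any integer $k\geq2$.
   Context: For a finite group $G$ let $G^*=G\setminus\{1\}$. For an inverse-closed $S\subseteq G^*$, $\mathrm{Cay}(G,S)$ has vertex set $G$ and edges $\{h,g\}$ with $gh^{ -1}\in S$. A partition of a set is a collection of non-empty pairwise disjoint subsets whose union is the set. $\mathrm{Cay}(G,S)$ is a $k$-if Cayley graph if there is a partition $\{S_0=S,\dots,S_{k-1}\}$ of $G^*$ into inverse-closed subsets with $\mathrm{Cay}(G,S_i)\cong\mathrm{Cay}(G,S)$ for all $i$; $G$ has the $k$-if property if some $\mathrm{Cay}(G,S)$ is a $k$-if Cayley graph. -}

module Defs where

open import Data.Nat using (ℕ)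
open import Data.Fin using (Fin)
open import Data.Fin.Subset using (Subset; _∈_; _∉_)
open import Data.Product using (Σ; ∃; _×_; _,_)
open import Algebra.Structures using (IsAbelianGroup)
open import Relation.Binary.PropositionalEquality using (_≡_; _≢_)
open import Function.Bundles using (_⤖_; _⇔_; Bijection)

-- A finite abelian group of order n, with carrier Fin n (every finite
-- group is isomorphic to one of this form) and propositional equality.
record FiniteAbelianGroup : Set₁ where
  field
    order : ℕ
    _∙_   : Fin order → Fin order → Fin order
    ε     : Fin order
    _⁻¹   : Fin order → Fin order
    isAbelianGroup : IsAbelianGroup _≡_ _∙_ ε _⁻¹

module _ (G : FiniteAbelianGroup) where
  open FiniteAbelianGroup G

  IsElementaryAbelian2 : Set
  IsElementaryAbelian2 = ∀ g → g ∙ g ≡ ε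

  InverseClosed : Subset order → Set
  InverseClosed S = ∀ g → g ∈ S → (g ⁻¹) ∈ S

  CayAdj : Subset order → Fin order → Fin order → Set
  CayAdj S h g = (g ∙ (h ⁻¹)) ∈ S

  CayIso : Subset order → Subset order → Set
  CayIso S T = Σ (Fin order ⤖ Fin order) λ f →
    ∀ h g → CayAdj S h g ⇔ CayAdj T (Bijection.to f h) (Bijection.to f g)

  IsPartitionOfG* : (k : ℕ) → (Fin k → Subset order) → Set
  IsPartitionOfG* k P =
    (∀ i → ∃ λ g → g ∈ P i) ×
    (∀ i → ε ∉ P i) ×
    (∀ g → g ≢ ε → ∃ λ i → g ∈ P i) ×
    (∀ g i j → g ∈ P i → g ∈ P j → i ≡ j)

  IsKIfCayley : ℕ → Subset order → Set
  IsKIfCayley k S =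
    InverseClosed S × ε ∉ S ×
    Σ (Fin k → Subset order) λ P →
      IsPartitionOfG* k P ×
      (∃ λ i → P i ≡ S) ×
      (∀ i → InverseClosed (P i)) ×
      (∀ i → CayIso (P i) S)

  HasKIfProperty : ℕ → Set
  HasKIfProperty k = ∃ λ S → IsKIfCayley k S

{-# OPTIONS --safe #-}
-- Isomorphic Cayley graphs have equal degree, and Cay(G,S) has degree |S|; so the k parts
-- of a k-if partition of G ∖ {1} all have size |S|, giving k · |S| = |G| − 1. When this is
-- prime and k ≥ 2, |S| = 1, so every part is an inverse-closed singleton {g}, i.e. g = g⁻¹
-- for all g, and G is an elementary abelian 2-group.
module Submission where

open import Defs
open import Data.Nat using (ℕ; _∸_; _≥_)
open import Data.Nat.Primality using (Prime)
open import Data.Nat.Divisibility using (_∣_)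
open import Relation.Nullary using (¬_)

open import Data.Nat using (zero; suc; s≤s; _+_; _*_; _≤_; _<_)
open import Data.Nat.Properties
  using (+-0-commutativeMonoid; *-identityʳ; *-zeroʳ; m<m*n; m+n∸n≡m; ≤-<-trans)
open import Data.Nat.Primality using (Composite; composite; composite⇒¬prime)
open import Data.Nat.Divisibility using (m∣m*n)
open import Data.Bool using (true; false; if_then_else_)
open import Data.Fin using (Fin; _≟_)
open import Data.Fin.Subset using (Subset; _∈_; _∉_; ∣_∣; ⁅_⁆)
open import Data.Fin.Subset.Properties
  using (_∈?_; x∈⁅x⁆; x∈⁅y⁆⇒x≡y; x∈⁅y⁆⇔x≡y; x≢y⇒x∉⁅y⁆; ∣⁅x⁆∣≡1;
         p⊆q⇒∣p∣≤∣q∣; x∈p∧x≢y⇒x∈p-y; x∈p⇒∣p-x∣<∣p∣)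
open import Data.Vec using ([]; _∷_; lookup)
open import Data.Vec.Properties using ([]=⇒lookup; lookup⇒[]=)
open import Data.Product using (_,_; ∃)
open import Function using (_∘_)
open import Function.Bundles using (_⇔_; _↔_; Bijection; Equivalence; Inverse; mk⇔; mk↔ₛ′)
open import Function.Construct.Composition using (_↔-∘_; _⇔-∘_)
import Function.Properties.Equivalence as ⇔
open import Function.Properties.Bijection using (⤖⇒↔)
open import Algebra.Structures using (IsAbelianGroup)
open import Algebra.Properties.CommutativeMonoid.Sum +-0-commutativeMonoid
  using (sum; sum-cong-≗; sum-permute; ∑-comm; ∑-distrib-+)
open import Relation.Nullary using (yes; no; contradiction)
open import Relation.Nullary.Decidable using (decidable-stable)
open import Relation.Binary.PropositionalEquality

private
  variable
    k m n : ℕ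

∑-const : ∀ n m → sum {n} (λ _ → m) ≡ n * m
∑-const zero    m = refl
∑-const (suc n) m = cong (m +_) (∑-const n m)

*-composite : ∀ {m n} → 1 < m → 1 < n → Composite (m * n)
*-composite {m@(suc (suc _))} {n} (s≤s (s≤s _)) 1<n = composite (m<m*n m n 1<n) (m∣m*n n)

indicator : Subset n → Fin n → ℕ
indicator p x = if lookup p x then 1 else 0

indicator-∈ : ∀ {p : Subset n} {x} → x ∈ p → indicator p x ≡ 1
indicator-∈ x∈p rewrite []=⇒lookup x∈p = refl

indicator-∉ : ∀ {p : Subset n} {x} → x ∉ p → indicator p x ≡ 0
indicator-∉ {p = p} {x} x∉p with lookup p x in eq
... | true  = contradiction (lookup⇒[]= x p eq) x∉p
... | false = refl

indicator-cong-⇔ : ∀ {p : Subset m} {q : Subset n} {x y} →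
  x ∈ p ⇔ y ∈ q → indicator p x ≡ indicator q y
indicator-cong-⇔ {p = p} {x = x} x∈p⇔y∈q with x ∈? p
... | yes x∈p = trans (indicator-∈ x∈p) (sym (indicator-∈ (Equivalence.to x∈p⇔y∈q x∈p)))
... | no  x∉p = trans (indicator-∉ x∉p) (sym (indicator-∉ (x∉p ∘ Equivalence.from x∈p⇔y∈q)))

∣p∣≡∑indicator : (p : Subset n) → ∣ p ∣ ≡ sum (indicator p)
∣p∣≡∑indicator []          = refl
∣p∣≡∑indicator (true ∷ p)  = cong suc (∣p∣≡∑indicator p)
∣p∣≡∑indicator (false ∷ p) = ∣p∣≡∑indicator p

∣∣-preserved-by-↔ : ∀ {p : Subset m} {q : Subset n} (f : Fin m ↔ Fin n) →
  (∀ x → x ∈ p ⇔ Inverse.to f x ∈ q) → ∣ p ∣ ≡ ∣ q ∣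
∣∣-preserved-by-↔ {p = p} {q} f x∈p⇔fx∈q = begin
  ∣ p ∣                            ≡⟨ ∣p∣≡∑indicator p ⟩
  sum (indicator p)                ≡⟨ sum-cong-≗ (λ x → indicator-cong-⇔ (x∈p⇔fx∈q x)) ⟩
  sum (indicator q ∘ Inverse.to f) ≡⟨ sum-permute (indicator q) f ⟨
  sum (indicator q)                ≡⟨ ∣p∣≡∑indicator q ⟨
  ∣ q ∣                            ∎
  where open ≡-Reasoning

x∈p⇒0<∣p∣ : ∀ {p : Subset n} {x} → x ∈ p → 0 < ∣ p ∣
x∈p⇒0<∣p∣ {x = x} x∈p = subst (_≤ _) (∣⁅x⁆∣≡1 x)
  (p⊆q⇒∣p∣≤∣q∣ λ y∈⁅x⁆ → subst (_∈ _) (sym (x∈⁅y⁆⇒x≡y x y∈⁅x⁆)) x∈p)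

x≢y⇒1<∣p∣ : ∀ {p : Subset n} {x y} → x ≢ y → x ∈ p → y ∈ p → 1 < ∣ p ∣
x≢y⇒1<∣p∣ x≢y x∈p y∈p =
  ≤-<-trans (x∈p⇒0<∣p∣ (x∈p∧x≢y⇒x∈p-y y∈p (x≢y ∘ sym))) (x∈p⇒∣p-x∣<∣p∣ x∈p)

∑-indicator-unique : ∀ (P : Fin k → Subset n) {x i} → x ∈ P i → (∀ j → x ∈ P j → j ≡ i) →
  sum (λ j → indicator (P j) x) ≡ 1
∑-indicator-unique P {x} {i} x∈Pi unique = begin
  sum (λ j → indicator (P j) x) ≡⟨ sum-cong-≗ (λ j → indicator-cong-⇔ (x∈Pj⇔j∈⁅i⁆ j)) ⟩
  sum (indicator ⁅ i ⁆)         ≡⟨ ∣p∣≡∑indicator ⁅ i ⁆ ⟨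
  ∣ ⁅ i ⁆ ∣                     ≡⟨ ∣⁅x⁆∣≡1 i ⟩
  1                             ∎
  where
  open ≡-Reasoning
  x∈Pj⇔j∈⁅i⁆ : ∀ j → x ∈ P j ⇔ j ∈ ⁅ i ⁆
  x∈Pj⇔j∈⁅i⁆ j = ⇔.sym x∈⁅y⁆⇔x≡y ⇔-∘ mk⇔ (unique j) λ { refl → x∈Pi }

∑-indicator-none : ∀ (P : Fin k → Subset n) {x} → (∀ j → x ∉ P j) →
  sum (λ j → indicator (P j) x) ≡ 0
∑-indicator-none {k} P {x} x∉P = begin
  sum (λ j → indicator (P j) x) ≡⟨ sum-cong-≗ (λ j → indicator-∉ (x∉P j)) ⟩
  sum {k} (λ _ → 0)             ≡⟨ ∑-const k 0 ⟩
  k * 0                         ≡⟨ *-zeroʳ k ⟩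
  0                             ∎
  where open ≡-Reasoning

∑∣∣-partition-of-complement : ∀ (a : Fin n) (P : Fin k → Subset n) →
  (∀ i → a ∉ P i) →
  (∀ x → x ≢ a → ∃ λ i → x ∈ P i) →
  (∀ x i j → x ∈ P i → x ∈ P j → i ≡ j) →
  sum (λ i → ∣ P i ∣) + 1 ≡ n
∑∣∣-partition-of-complement {n} a P a∉P cover disjoint = begin
  sum (λ i → ∣ P i ∣) + 1
    ≡⟨ cong₂ _+_ (sum-cong-≗ (∣p∣≡∑indicator ∘ P)) (sym (∣⁅x⁆∣≡1 a)) ⟩
  sum (λ i → sum (indicator (P i))) + ∣ ⁅ a ⁆ ∣
    ≡⟨ cong₂ _+_ (∑-comm (indicator ∘ P)) (∣p∣≡∑indicator ⁅ a ⁆) ⟩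
  sum (λ x → sum (λ i → indicator (P i) x)) + sum (indicator ⁅ a ⁆)
    ≡⟨ ∑-distrib-+ (λ x → sum (λ i → indicator (P i) x)) (indicator ⁅ a ⁆) ⟨
  sum (λ x → sum (λ i → indicator (P i) x) + indicator ⁅ a ⁆ x)
    ≡⟨ sum-cong-≗ covered-once ⟩
  sum {n} (λ _ → 1)
    ≡⟨ ∑-const n 1 ⟩
  n * 1
    ≡⟨ *-identityʳ n ⟩
  n ∎
  where
  open ≡-Reasoning
  covered-once : ∀ x → sum (λ i → indicator (P i) x) + indicator ⁅ a ⁆ x ≡ 1
  covered-once x with x ≟ a
  ... | yes refl = cong₂ _+_ (∑-indicator-none P a∉P) (indicator-∈ (x∈⁅x⁆ a))
  ... | no x≢a with cover x x≢a
  ...   | i , x∈Pi = cong₂ _+_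
          (∑-indicator-unique P x∈Pi (λ j x∈Pj → disjoint x j i x∈Pj x∈Pi))
          (indicator-∉ (x≢y⇒x∉⁅y⁆ x≢a))

module _ (G : FiniteAbelianGroup) where
  open FiniteAbelianGroup G
  open IsAbelianGroup isAbelianGroup using (assoc; identityʳ; inverseˡ; inverseʳ)

  x∙y⁻¹∙y≡x : ∀ x y → (x ∙ (y ⁻¹)) ∙ y ≡ x
  x∙y⁻¹∙y≡x x y = trans (assoc x (y ⁻¹) y) (trans (cong (x ∙_) (inverseˡ y)) (identityʳ x))

  x∙y∙y⁻¹≡x : ∀ x y → (x ∙ y) ∙ (y ⁻¹) ≡ x
  x∙y∙y⁻¹≡x x y = trans (assoc x y (y ⁻¹)) (trans (cong (x ∙_) (inverseʳ y)) (identityʳ x))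

  x∙ε⁻¹≡x : ∀ x → x ∙ (ε ⁻¹) ≡ x
  x∙ε⁻¹≡x x = trans (cong (_∙ (ε ⁻¹)) (sym (identityʳ x))) (x∙y∙y⁻¹≡x x ε)

  translateʳ : Fin order → Fin order ↔ Fin order
  translateʳ c = mk↔ₛ′ (_∙ c) (_∙ (c ⁻¹)) (λ x → x∙y⁻¹∙y≡x x c) (λ x → x∙y∙y⁻¹≡x x c)

  -- f maps the neighbourhood T of ε in Cay(G,T) onto the neighbourhood S ∙ f ε of f ε in
  -- Cay(G,S); translating back by (f ε)⁻¹ gives a bijection carrying T onto S.
  CayIso⇒∣∣≡ : ∀ {T S} → CayIso G T S → ∣ T ∣ ≡ ∣ S ∣
  CayIso⇒∣∣≡ {T} {S} (f , adj) =
    ∣∣-preserved-by-↔ (translateʳ (Bijection.to f ε ⁻¹) ↔-∘ ⤖⇒↔ f) λ x →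
      subst (λ y → y ∈ T ⇔ (Bijection.to f x ∙ (Bijection.to f ε ⁻¹)) ∈ S)
        (x∙ε⁻¹≡x x) (adj ε x)

  IsKIfCayley⇒k*∣S∣+1≡order : ∀ {k S} → IsKIfCayley G k S → k * ∣ S ∣ + 1 ≡ order
  IsKIfCayley⇒k*∣S∣+1≡order {k} {S} (_ , _ , P , (_ , ε∉P , cover , disjoint) , _ , _ , P≅S) = begin
    k * ∣ S ∣ + 1             ≡⟨ cong (_+ 1) (∑-const k ∣ S ∣) ⟨
    sum {k} (λ _ → ∣ S ∣) + 1 ≡⟨ cong (_+ 1) (sum-cong-≗ (CayIso⇒∣∣≡ ∘ P≅S)) ⟨
    sum (λ i → ∣ P i ∣) + 1   ≡⟨ ∑∣∣-partition-of-complement ε P ε∉P cover disjoint ⟩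
    order                     ∎
    where open ≡-Reasoning

  IsKIfCayley⇒1<∣S∣ : ∀ {k S g} → IsKIfCayley G k S → g ∙ g ≢ ε → 1 < ∣ S ∣
  IsKIfCayley⇒1<∣S∣ {g = g} (_ , _ , P , (_ , _ , cover , _) , _ , P-inverseClosed , P≅S) g∙g≢ε
    with cover g (λ { refl → g∙g≢ε (identityʳ ε) })
  ... | i , g∈Pi = subst (1 <_) (CayIso⇒∣∣≡ (P≅S i))
    (x≢y⇒1<∣p∣ (λ g≡g⁻¹ → g∙g≢ε (trans (cong (g ∙_) g≡g⁻¹) (inverseʳ g)))
      g∈Pi (P-inverseClosed i g g∈Pi))

lemma4p6 : (G : FiniteAbelianGroup) →
    ¬ IsElementaryAbelian2 G →
    Prime (FiniteAbelianGroup.order G ∸ 1) →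
    ¬ (2 ∣ (FiniteAbelianGroup.order G ∸ 1)) →
    (k : ℕ) → k ≥ 2 → ¬ HasKIfProperty G k
lemma4p6 G ¬elementary prime[order∸1] _ k 1<k (S , kIf) =
  ¬elementary λ g → decidable-stable (g ∙ g ≟ ε) λ g∙g≢ε →
    composite⇒¬prime (*-composite 1<k (IsKIfCayley⇒1<∣S∣ G kIf g∙g≢ε))
      (subst Prime order∸1≡k*∣S∣ prime[order∸1])
  where
  open FiniteAbelianGroup G
  order∸1≡k*∣S∣ : order ∸ 1 ≡ k * ∣ S ∣
  order∸1≡k*∣S∣ =
    trans (cong (_∸ 1) (sym (IsKIfCayley⇒k*∣S∣+1≡order G kIf))) (m+n∸n≡m (k * ∣ S ∣) 1)
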